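{- Let $U$ be a set and $\mathcal R$ a set of partial bijections on $U$ that is closed under composition and inverse and such that $\mathrm{id}_{\{u\}}\in\mathcal R$ for every $u\in U$. Then for every first-order formula $A$ of the language of the structure $(U,\mathcal R)$ there is a quantifier-free formula $C$ containing no constant symbols that is equivalent to $A$ in $(U,\mathcal R)$.
   Context: A partial bijection on $U$ is a relation $R\subseteq U\times U$ which is a one-to-one correspondence between a subset of $U$ and a subset of $U$. For relations, $R^{ -1}=\{(y,x)\mid (x,y)\in R\}$, $R\circ S=\{(x,z)\mid\exists y.\,(x,y)\in S\wedge(y,z)\in R\}$, and $\mathrm{id}_X=\{(x,x)\mid x\in X\}$. $\mathcal R$ is closed under composition and inverse if $R,S\in\mathcal R$ implies $R^{ -1}\in\mathcal R$ and $R\circ S\in\mathcal R$. The structure $(U,\mathcal R)$ has universe $U$, a binary predicate symbol for each $R\in\mathcal R$, a constant symbol for each $u\in U$, and equality; "equivalent" means $A\leftrightarrow C$ holds in $(U,\mathcal R)$ under every assignment of the variables. -}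

module Defs where

open import Data.Nat using (ℕ; zero; suc)
open import Data.Product using (Σ; ∃; _×_; _,_)
open import Data.Sum using (_⊎_)
open import Data.Unit using (⊤)
open import Data.Empty using (⊥)
open import Relation.Nullary using (¬_)
open import Relation.Binary.PropositionalEquality using (_≡_)

Relation : Set → Set₁
Relation U = U → U → Set

IsPartialBijection : {U : Set} → Relation U → Set
IsPartialBijection {U} R =
  (∀ (x y y′ : U) → R x y → R x y′ → y ≡ y′) ×
  (∀ (x x′ y : U) → R x y → R x′ y → x ≡ x′)

_⁻¹ʳ : {U : Set} → Relation U → Relation U
(R ⁻¹ʳ) y x = R x y

_∘ʳ_ : {U : Set} → Relation U → Relation U → Relation U
(_∘ʳ_ {U} R S) x z = Σ U (λ y → S x y × R y z)

idSingleton : {U : Set} → U → Relation U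
idSingleton u x y = (x ≡ u) × (y ≡ u)

-- Terms: variables (de Bruijn indices) and constant symbols (one per u ∈ U)
data Term (U : Set) : Set where
  var : ℕ → Term U
  con : U → Term U

data Formula (U : Set) (𝓡 : Relation U → Set) : Set₁ where
  rel  : (R : Relation U) → 𝓡 R → Term U → Term U → Formula U 𝓡
  eqf  : Term U → Term U → Formula U 𝓡
  ⊤f   : Formula U 𝓡
  ⊥f   : Formula U 𝓡
  ¬f   : Formula U 𝓡 → Formula U 𝓡
  _∧f_ : Formula U 𝓡 → Formula U 𝓡 → Formula U 𝓡
  _∨f_ : Formula U 𝓡 → Formula U 𝓡 → Formula U 𝓡
  _⇒f_ : Formula U 𝓡 → Formula U 𝓡 → Formula U 𝓡
  ∀f   : Formula U 𝓡 → Formula U 𝓡   -- binds de Bruijn variable 0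
  ∃f   : Formula U 𝓡 → Formula U 𝓡   -- binds de Bruijn variable 0

data ConstFreeTerm {U : Set} : Term U → Set where
  var : (n : ℕ) → ConstFreeTerm (var n)

data QFConstFree {U : Set} {𝓡 : Relation U → Set} : Formula U 𝓡 → Set₁ where
  rel  : ∀ R (p : 𝓡 R) {s t} → ConstFreeTerm s → ConstFreeTerm t → QFConstFree (rel R p s t)
  eqf  : ∀ {s t} → ConstFreeTerm s → ConstFreeTerm t → QFConstFree (eqf s t)
  ⊤f   : QFConstFree ⊤f
  ⊥f   : QFConstFree ⊥f
  ¬f   : ∀ {A} → QFConstFree A → QFConstFree (¬f A)
  _∧f_ : ∀ {A B} → QFConstFree A → QFConstFree B → QFConstFree (A ∧f B)
  _∨f_ : ∀ {A B} → QFConstFree A → QFConstFree B → QFConstFree (A ∨f B)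
  _⇒f_ : ∀ {A B} → QFConstFree A → QFConstFree B → QFConstFree (A ⇒f B)

Assignment : Set → Set
Assignment U = ℕ → U

_∷ᵃ_ : {U : Set} → U → Assignment U → Assignment U
(u ∷ᵃ ρ) zero = u
(u ∷ᵃ ρ) (suc n) = ρ n

evalTerm : {U : Set} → Assignment U → Term U → U
evalTerm ρ (var n) = ρ n
evalTerm ρ (con u) = u

Sat : {U : Set} {𝓡 : Relation U → Set} → Formula U 𝓡 → Assignment U → Set
Sat (rel R _ s t) ρ = R (evalTerm ρ s) (evalTerm ρ t)
Sat (eqf s t) ρ = evalTerm ρ s ≡ evalTerm ρ t
Sat ⊤f ρ = ⊤
Sat ⊥f ρ = ⊥
Sat (¬f A) ρ = ¬ Sat A ρ
Sat (A ∧f B) ρ = Sat A ρ × Sat B ρ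
Sat (A ∨f B) ρ = Sat A ρ ⊎ Sat B ρ
Sat (A ⇒f B) ρ = Sat A ρ → Sat B ρ
Sat {U} (∀f A) ρ = (u : U) → Sat A (u ∷ᵃ ρ)
Sat {U} (∃f A) ρ = Σ U (λ u → Sat A (u ∷ᵃ ρ))

Equivalent : {U : Set} {𝓡 : Relation U → Set} → Formula U 𝓡 → Formula U 𝓡 → Set
Equivalent {U} A C = (ρ : Assignment U) → (Sat A ρ → Sat C ρ) × (Sat C ρ → Sat A ρ)

-- Constants are definable from the partial bijections: R y u holds iff (R⁻¹ ∘ id_{u} ∘ R) y y,
-- and closed atoms are simply true or false. To eliminate ∃x from a quantifier-free q, note that an
-- atom x R y or y R x or x = y with another variable y pins x down as the unique preimage of y under
-- a partial bijection (or as y itself); substituting that preimage is expressible through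
-- compositions with R⁻¹. A witness pinned by no atom of q is constrained only through the loop
-- atoms R x x. If q has k pinning atoms, choose (classically) a finite set L of elements such that
-- every element is in L or agrees on all loop atoms with k+1 distinct members of L; each pinning
-- atom excludes at most one of these, so one of them is an unpinned witness as well. Hence ∃x.q is
-- the disjunction of q[d/x] for d ∈ L together with q with each pinned value substituted.

module Submission where

open import Defs
open import Level using (0ℓ)
open import Axiom.ExcludedMiddle using (ExcludedMiddle)
open import Data.Empty using (⊥-elim)
open import Data.Nat using (ℕ; zero; suc; _<_; _≤_; z≤n; s≤s)
open import Data.Nat.Properties using (≤-refl; ≤-trans; ≤-pred)
open import Data.Product using (Σ; ∃-syntax; _×_; _,_; proj₁; proj₂)
open import Data.Product.Function.Dependent.Propositional using (congˡ)
open import Data.Product.Function.NonDependent.Propositional using (_×-⇔_)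
open import Data.Sum as Sum using (_⊎_; inj₁; inj₂)
open import Data.Sum.Function.Propositional using (_⊎-⇔_)
open import Data.Unit using (⊤; tt)
open import Data.List using (List; []; _∷_; [_]; _++_; length; concatMap)
open import Data.List.Membership.Propositional using (_∈_; _∉_; find; lose)
open import Data.List.Membership.Propositional.Properties using (∈-++⁺ˡ; ∈-++⁺ʳ)
open import Data.List.Relation.Binary.Subset.Propositional using (_⊆_)
open import Data.List.Relation.Unary.All as All using (All; []; _∷_)
open import Data.List.Relation.Unary.All.Properties using (¬Any⇒All¬; anti-mono; ++⁻ˡ; ++⁻ʳ; concat⁻; map⁻)
open import Data.List.Relation.Unary.Any as Any using (Any; here; there; any?)
open import Data.List.Relation.Unary.Unique.Propositional using (Unique; []; _∷_)
open import Function using (_∘_)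
open import Function.Bundles using (_⇔_; mk⇔; Equivalence)
open import Function.Construct.Identity using (⇔-id)
open import Function.Construct.Symmetry using (⇔-sym)
open import Function.Construct.Composition using (_⇔-∘_)
open import Function.Related.TypeIsomorphisms using (¬-cong-⇔; →-cong-⇔)
open import Relation.Nullary using (¬_; yes; no)
open import Relation.Nullary.Decidable using (decidable-stable)
open import Relation.Binary.PropositionalEquality using (_≡_; refl; sym; trans; cong; cong₂; subst; subst₂)

open Equivalence using (to; from)

both-false : {A B : Set} → ¬ A → ¬ B → A ⇔ B
both-false ¬A ¬B = mk⇔ (⊥-elim ∘ ¬A) (⊥-elim ∘ ¬B)

both-true : {A B : Set} → A → B → A ⇔ B
both-true a b = mk⇔ (λ _ → b) (λ _ → a)

Π-cong-⇔ : ∀ {a} {A : Set a} {P Q : A → Set} → (∀ x → P x ⇔ Q x) → ((x : A) → P x) ⇔ ((x : A) → Q x)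
Π-cong-⇔ P⇔Q = mk⇔ (λ ∀P x → to (P⇔Q x) (∀P x)) (λ ∀Q x → from (P⇔Q x) (∀Q x))

module Classical (em : ExcludedMiddle 0ℓ) {U : Set} where

  ∀⇔¬∃¬ : {P : U → Set} → (∀ x → P x) ⇔ (¬ (∃[ x ] ¬ P x))
  ∀⇔¬∃¬ = mk⇔ (λ ∀P (x , ¬Px) → ¬Px (∀P x))
              (λ ∄ x → decidable-stable em (λ ¬Px → ∄ (x , ¬Px)))

  AtMostOne : (U → Set) → Set
  AtMostOne P = ∀ {x y} → P x → P y → x ≡ y

  remove-atMostOne : {P : U → Set} {xs : List U} → AtMostOne P → Unique xs →
                     ∃[ ys ] Unique ys × ys ⊆ xs × All (¬_ ∘ P) ys × length xs ≤ suc (length ys)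
  remove-atMostOne {xs = []} _ [] = [] , [] , (λ ()) , [] , z≤n
  remove-atMostOne {P} {x ∷ xs} P! (x∉xs ∷ uxs) with em {P x}
  ... | yes Px = xs , uxs , there , All.map (λ x≢y Py → x≢y (P! Px Py)) x∉xs , ≤-refl
  ... | no ¬Px with remove-atMostOne P! uxs
  ...   | ys , uys , ys⊆xs , ¬Pys , len =
          x ∷ ys , anti-mono ys⊆xs x∉xs ∷ uys
          , (λ { (here refl) → here refl ; (there y∈) → there (ys⊆xs y∈) })
          , ¬Px ∷ ¬Pys , s≤s len

  pigeonhole-avoiding : ∀ {a} {A : Set a} (P : A → U → Set) (as : List A) {xs : List U} →
                        All (AtMostOne ∘ P) as → Unique xs → length as < length xs →
                        ∃[ d ] d ∈ xs × All (λ a → ¬ P a d) as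
  pigeonhole-avoiding P [] {x ∷ _} [] _ _ = x , here refl , []
  pigeonhole-avoiding P (a ∷ as) (Pa! ∷ P!) uxs as<xs with remove-atMostOne Pa! uxs
  ... | ys , uys , ys⊆xs , ¬Pys , len with pigeonhole-avoiding P as P! uys (≤-pred (≤-trans as<xs len))
  ...   | d , d∈ys , avoids = d , ys⊆xs d∈ys , All.lookup ¬Pys d∈ys ∷ avoids

  Agree : List (U → Set) → U → U → Set₁
  Agree Ps x y = All (λ P → P x ⇔ P y) Ps

  Crowded : ℕ → List (U → Set) → (U → Set) → List U → U → Set₁
  Crowded k Ps D L x = ∃[ S ] Unique S × k < length S × All (λ y → y ∈ L × D y × Agree Ps x y) S

  Covers : ℕ → List (U → Set) → (U → Set) → List U → Set₁
  Covers k Ps D L = ∀ {x} → D x → x ∈ L ⊎ Crowded k Ps D L x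

  listed-or-large : (D : U → Set) (n : ℕ) →
                    (∃[ L ] ∀ {x} → D x → x ∈ L) ⊎ (∃[ S ] Unique S × n ≤ length S × All D S)
  listed-or-large D zero = inj₂ ([] , [] , z≤n , [])
  listed-or-large D (suc n) with listed-or-large D n
  ... | inj₁ listed = inj₁ listed
  ... | inj₂ (S , uS , n≤|S| , DS) with em {∃[ y ] D y × y ∉ S}
  ...   | yes (y , Dy , y∉S) = inj₂ (y ∷ S , ¬Any⇒All¬ S y∉S ∷ uS , s≤s n≤|S| , Dy ∷ DS)
  ...   | no ∄ = inj₁ (S , λ {x} Dx → decidable-stable em (λ x∉S → ∄ (x , Dx , x∉S)))

  crowded-refine : ∀ {k Ps D D′ L L′ x} (P : U → Set) → L ⊆ L′ → (∀ {y} → D y → D′ y × (P x ⇔ P y)) →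
                   Crowded k Ps D L x → Crowded k (P ∷ Ps) D′ L′ x
  crowded-refine {Ps = Ps} {D} {D′} {L} {L′} {x} P L⊆L′ D⇒ (S , uS , k<|S| , S-good) =
    S , uS , k<|S| , All.map refine S-good
    where
    refine : ∀ {y} → y ∈ L × D y × Agree Ps x y → y ∈ L′ × D′ y × Agree (P ∷ Ps) x y
    refine (y∈L , Dy , agree) = let D′y , Px⇔Py = D⇒ Dy in L⊆L′ y∈L , D′y , Px⇔Py ∷ agree

  cover : (k : ℕ) (Ps : List (U → Set)) (D : U → Set) → ∃[ L ] Covers k Ps D L
  cover k [] D with listed-or-large D (suc k)
  ... | inj₁ (L , D⊆L) = L , λ Dx → inj₁ (D⊆L Dx)
  ... | inj₂ (S , uS , k<|S| , DS) =
    S , λ _ → inj₂ (S , uS , k<|S| , All.tabulate (λ y∈S → y∈S , All.lookup DS y∈S , []))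
  cover k (P ∷ Ps) D with cover k Ps (λ x → D x × P x) | cover k Ps (λ x → D x × ¬ P x)
  ... | L₁ , covers₁ | L₂ , covers₂ = L₁ ++ L₂ , covers
    where
    covers : Covers k (P ∷ Ps) D (L₁ ++ L₂)
    covers {x} Dx with em {P x}
    ... | yes Px = Sum.map ∈-++⁺ˡ
                     (crowded-refine P ∈-++⁺ˡ (λ (Dy , Py) → Dy , both-true Px Py))
                     (covers₁ (Dx , Px))
    ... | no ¬Px = Sum.map (∈-++⁺ʳ L₁)
                     (crowded-refine P (∈-++⁺ʳ L₁) (λ (Dy , ¬Py) → Dy , both-false ¬Px ¬Py))
                     (covers₂ (Dx , ¬Px))

module QuantifierFree (U : Set) (𝓡 : Relation U → Set) where

  data Atom : Set₁ where
    rel : (R : Relation U) → 𝓡 R → ℕ → ℕ → Atom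
    eq  : ℕ → ℕ → Atom

  infixr 8 _∧q_
  infixr 7 _∨q_
  infixr 6 _⇒q_

  data QF : Set₁ where
    atom : Atom → QF
    ⊤q ⊥q : QF
    ¬q : QF → QF
    _∧q_ _∨q_ _⇒q_ : QF → QF → QF

  ⌜_⌝ : QF → Formula U 𝓡
  ⌜ atom (rel R r i j) ⌝ = rel R r (var i) (var j)
  ⌜ atom (eq i j) ⌝ = eqf (var i) (var j)
  ⌜ ⊤q ⌝ = ⊤f
  ⌜ ⊥q ⌝ = ⊥f
  ⌜ ¬q q ⌝ = ¬f ⌜ q ⌝
  ⌜ q ∧q q′ ⌝ = ⌜ q ⌝ ∧f ⌜ q′ ⌝
  ⌜ q ∨q q′ ⌝ = ⌜ q ⌝ ∨f ⌜ q′ ⌝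
  ⌜ q ⇒q q′ ⌝ = ⌜ q ⌝ ⇒f ⌜ q′ ⌝

  ⌜⌝-qfConstFree : ∀ q → QFConstFree ⌜ q ⌝
  ⌜⌝-qfConstFree (atom (rel R r i j)) = rel R r (var i) (var j)
  ⌜⌝-qfConstFree (atom (eq i j)) = eqf (var i) (var j)
  ⌜⌝-qfConstFree ⊤q = ⊤f
  ⌜⌝-qfConstFree ⊥q = ⊥f
  ⌜⌝-qfConstFree (¬q q) = ¬f (⌜⌝-qfConstFree q)
  ⌜⌝-qfConstFree (q ∧q q′) = ⌜⌝-qfConstFree q ∧f ⌜⌝-qfConstFree q′
  ⌜⌝-qfConstFree (q ∨q q′) = ⌜⌝-qfConstFree q ∨f ⌜⌝-qfConstFree q′
  ⌜⌝-qfConstFree (q ⇒q q′) = ⌜⌝-qfConstFree q ⇒f ⌜⌝-qfConstFree q′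

  ⟦_⟧ : QF → Assignment U → Set
  ⟦ q ⟧ = Sat ⌜ q ⌝

  atoms : QF → List Atom
  atoms (atom a) = [ a ]
  atoms ⊤q = []
  atoms ⊥q = []
  atoms (¬q q) = atoms q
  atoms (q ∧q q′) = atoms q ++ atoms q′
  atoms (q ∨q q′) = atoms q ++ atoms q′
  atoms (q ⇒q q′) = atoms q ++ atoms q′

  bind : (Atom → QF) → QF → QF
  bind f (atom a) = f a
  bind f ⊤q = ⊤q
  bind f ⊥q = ⊥q
  bind f (¬q q) = ¬q (bind f q)
  bind f (q ∧q q′) = bind f q ∧q bind f q′
  bind f (q ∨q q′) = bind f q ∨q bind f q′
  bind f (q ⇒q q′) = bind f q ⇒q bind f q′

  bind-sound : ∀ (f : Atom → QF) {ρ ρ′} q → All (λ a → ⟦ f a ⟧ ρ′ ⇔ ⟦ atom a ⟧ ρ) (atoms q) →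
               ⟦ bind f q ⟧ ρ′ ⇔ ⟦ q ⟧ ρ
  bind-sound f (atom a) (f≈a ∷ []) = f≈a
  bind-sound f ⊤q _ = ⇔-id _
  bind-sound f ⊥q _ = ⇔-id _
  bind-sound f (¬q q) h = ¬-cong-⇔ (bind-sound f q h)
  bind-sound f (q ∧q q′) h = bind-sound f q (++⁻ˡ _ h) ×-⇔ bind-sound f q′ (++⁻ʳ _ h)
  bind-sound f (q ∨q q′) h = bind-sound f q (++⁻ˡ _ h) ⊎-⇔ bind-sound f q′ (++⁻ʳ _ h)
  bind-sound f (q ⇒q q′) h = →-cong-⇔ (bind-sound f q (++⁻ˡ _ h)) (bind-sound f q′ (++⁻ʳ _ h))

  bind-atom : ∀ q → bind atom q ≡ q
  bind-atom (atom a) = refl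
  bind-atom ⊤q = refl
  bind-atom ⊥q = refl
  bind-atom (¬q q) = cong ¬q (bind-atom q)
  bind-atom (q ∧q q′) = cong₂ _∧q_ (bind-atom q) (bind-atom q′)
  bind-atom (q ∨q q′) = cong₂ _∨q_ (bind-atom q) (bind-atom q′)
  bind-atom (q ⇒q q′) = cong₂ _⇒q_ (bind-atom q) (bind-atom q′)

  atoms-cong : ∀ {ρ ρ′} q → All (λ a → ⟦ atom a ⟧ ρ′ ⇔ ⟦ atom a ⟧ ρ) (atoms q) → ⟦ q ⟧ ρ′ ⇔ ⟦ q ⟧ ρ
  atoms-cong {ρ} {ρ′} q h = subst (λ q′ → ⟦ q′ ⟧ ρ′ ⇔ ⟦ q ⟧ ρ) (bind-atom q) (bind-sound atom q h)

  ⋁ : ∀ {a} {A : Set a} → (A → QF) → List A → QF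
  ⋁ f [] = ⊥q
  ⋁ f (x ∷ xs) = f x ∨q ⋁ f xs

  ⋁-sound : ∀ {a} {A : Set a} (f : A → QF) xs {ρ} → ⟦ ⋁ f xs ⟧ ρ ⇔ Any (λ x → ⟦ f x ⟧ ρ) xs
  ⋁-sound f [] = mk⇔ (λ ()) (λ ())
  ⋁-sound f (x ∷ xs) = mk⇔ (λ { (inj₁ fx) → here fx ; (inj₂ fxs) → there (to (⋁-sound f xs) fxs) })
                           (λ { (here fx) → inj₁ fx ; (there fxs) → inj₂ (from (⋁-sound f xs) fxs) })

module QuantifierElimination
  (em : ExcludedMiddle 0ℓ) (U : Set) (𝓡 : Relation U → Set)
  (partialBijection : ∀ R → 𝓡 R → IsPartialBijection R)
  (inverse : ∀ R → 𝓡 R → 𝓡 (R ⁻¹ʳ))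
  (composition : ∀ R S → 𝓡 R → 𝓡 S → 𝓡 (R ∘ʳ S))
  (singleton : ∀ u → 𝓡 (idSingleton u)) where

  open Classical em
  open QuantifierFree U 𝓡

  infix 10 _⁻¹ᵣ
  infixr 9 _∘ᵣ_

  _⁻¹ᵣ : ∀ {R} → 𝓡 R → 𝓡 (R ⁻¹ʳ)
  r ⁻¹ᵣ = inverse _ r

  _∘ᵣ_ : ∀ {R S} → 𝓡 R → 𝓡 S → 𝓡 (R ∘ʳ S)
  r ∘ᵣ s = composition _ _ r s

  truthValue : Set → QF
  truthValue P with em {P}
  ... | yes _ = ⊤q
  ... | no _ = ⊥q

  truthValue-sound : ∀ P {ρ} → ⟦ truthValue P ⟧ ρ ⇔ P
  truthValue-sound P with em {P}
  ... | yes p = mk⇔ (λ _ → p) (λ _ → tt)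
  ... | no ¬p = mk⇔ (λ ()) ¬p

  relTerms : (R : Relation U) → 𝓡 R → Term U → Term U → QF
  relTerms R r (var i) (var j) = atom (rel R r i j)
  relTerms R r (var i) (con u) =
    atom (rel ((R ⁻¹ʳ) ∘ʳ (idSingleton u ∘ʳ R)) (r ⁻¹ᵣ ∘ᵣ singleton u ∘ᵣ r) i i)
  relTerms R r (con u) (var j) = relTerms (R ⁻¹ʳ) (r ⁻¹ᵣ) (var j) (con u)
  relTerms R r (con u) (con v) = truthValue (R u v)

  relTerms-sound : ∀ R r s t {ρ} → ⟦ relTerms R r s t ⟧ ρ ⇔ R (evalTerm ρ s) (evalTerm ρ t)
  relTerms-sound R r (var i) (var j) = ⇔-id _
  relTerms-sound R r (var i) (con u) =
    mk⇔ (λ { (_ , (_ , Rxu , refl , refl) , _) → Rxu }) (λ Rxu → u , (u , Rxu , refl , refl) , Rxu)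
  relTerms-sound R r (con u) (var j) {ρ} = relTerms-sound (R ⁻¹ʳ) (r ⁻¹ᵣ) (var j) (con u) {ρ}
  relTerms-sound R r (con u) (con v) = truthValue-sound (R u v)

  eqTerms : Term U → Term U → QF
  eqTerms (var i) (var j) = atom (eq i j)
  eqTerms (var i) (con u) = atom (rel (idSingleton u) (singleton u) i i)
  eqTerms (con u) (var j) = eqTerms (var j) (con u)
  eqTerms (con u) (con v) = truthValue (u ≡ v)

  eqTerms-sound : ∀ s t {ρ} → ⟦ eqTerms s t ⟧ ρ ⇔ (evalTerm ρ s ≡ evalTerm ρ t)
  eqTerms-sound (var i) (var j) = ⇔-id _
  eqTerms-sound (var i) (con u) = mk⇔ proj₁ (λ x≡u → x≡u , x≡u)
  eqTerms-sound (con u) (var j) = mk⇔ (sym ∘ proj₁) (λ u≡x → sym u≡x , sym u≡x)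
  eqTerms-sound (con u) (con v) = truthValue-sound (u ≡ v)

  sub₀ : Term U → ℕ → Term U
  sub₀ t zero = t
  sub₀ t (suc n) = var n

  evalTerm-sub₀ : ∀ t n {ρ} → evalTerm ρ (sub₀ t n) ≡ (evalTerm ρ t ∷ᵃ ρ) n
  evalTerm-sub₀ t zero = refl
  evalTerm-sub₀ t (suc n) = refl

  substAtom : Term U → Atom → QF
  substAtom t (rel R r i j) = relTerms R r (sub₀ t i) (sub₀ t j)
  substAtom t (eq i j) = eqTerms (sub₀ t i) (sub₀ t j)

  substAtom-sound : ∀ t a {ρ} → ⟦ substAtom t a ⟧ ρ ⇔ ⟦ atom a ⟧ (evalTerm ρ t ∷ᵃ ρ)
  substAtom-sound t (rel R r i j) {ρ} = subst₂ (λ x y → ⟦ substAtom t (rel R r i j) ⟧ ρ ⇔ R x y)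
    (evalTerm-sub₀ t i) (evalTerm-sub₀ t j) (relTerms-sound R r (sub₀ t i) (sub₀ t j))
  substAtom-sound t (eq i j) {ρ} = subst₂ (λ x y → ⟦ substAtom t (eq i j) ⟧ ρ ⇔ x ≡ y)
    (evalTerm-sub₀ t i) (evalTerm-sub₀ t j) (eqTerms-sound (sub₀ t i) (sub₀ t j))

  _[_/0] : QF → Term U → QF
  q [ t /0] = bind (substAtom t) q

  [/0]-sound : ∀ q t {ρ} → ⟦ q [ t /0] ⟧ ρ ⇔ ⟦ q ⟧ (evalTerm ρ t ∷ᵃ ρ)
  [/0]-sound q t = bind-sound (substAtom t) q (All.universal (λ a → substAtom-sound t a) _)

  data Pin : Set₁ where
    via : (R : Relation U) → 𝓡 R → ℕ → Pin
    at  : ℕ → Pin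

  Pinned : Pin → Assignment U → U → Set
  Pinned (via R r j) ρ x = R x (ρ j)
  Pinned (at j) ρ x = x ≡ ρ j

  Unpinned : List Pin → Assignment U → U → Set₁
  Unpinned ps ρ x = All (λ p → ¬ Pinned p ρ x) ps

  pinned-atMostOne : ∀ ρ p → AtMostOne (Pinned p ρ)
  pinned-atMostOne ρ (via R r j) Rx Ry = proj₂ (partialBijection R r) _ _ _ Rx Ry
  pinned-atMostOne ρ (at j) x≡ y≡ = trans x≡ (sym y≡)

  -- Atoms are read in the scope of ∃x: variable 0 is x and variable suc j is ρ j.
  pinsOf : Atom → List Pin
  pinsOf (rel R r zero (suc j)) = [ via R r j ]
  pinsOf (rel R r (suc j) zero) = [ via (R ⁻¹ʳ) (r ⁻¹ᵣ) j ]
  pinsOf (eq zero (suc j)) = [ at j ]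
  pinsOf (eq (suc j) zero) = [ at j ]
  pinsOf _ = []

  loopsOf : Atom → List (U → Set)
  loopsOf (rel R r zero zero) = [ (λ x → R x x) ]
  loopsOf _ = []

  pins : QF → List Pin
  pins q = concatMap pinsOf (atoms q)

  loops : QF → List (U → Set)
  loops q = concatMap loopsOf (atoms q)

  atom-indiscernible : ∀ a {ρ x y} → Agree (loopsOf a) x y →
                       Unpinned (pinsOf a) ρ x → Unpinned (pinsOf a) ρ y →
                       ⟦ atom a ⟧ (x ∷ᵃ ρ) ⇔ ⟦ atom a ⟧ (y ∷ᵃ ρ)
  atom-indiscernible (rel R r zero zero) (Rxx⇔Ryy ∷ []) _ _ = Rxx⇔Ryy
  atom-indiscernible (rel R r zero (suc j)) _ (¬Rx ∷ []) (¬Ry ∷ []) = both-false ¬Rx ¬Ry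
  atom-indiscernible (rel R r (suc j) zero) _ (¬Rx ∷ []) (¬Ry ∷ []) = both-false ¬Rx ¬Ry
  atom-indiscernible (rel R r (suc i) (suc j)) _ _ _ = ⇔-id _
  atom-indiscernible (eq zero zero) _ _ _ = mk⇔ (λ _ → refl) (λ _ → refl)
  atom-indiscernible (eq zero (suc j)) _ (x≢ ∷ []) (y≢ ∷ []) = both-false x≢ y≢
  atom-indiscernible (eq (suc j) zero) _ (x≢ ∷ []) (y≢ ∷ []) = both-false (x≢ ∘ sym) (y≢ ∘ sym)
  atom-indiscernible (eq (suc i) (suc j)) _ _ _ = ⇔-id _

  indiscernible : ∀ q {ρ x y} → Agree (loops q) x y → Unpinned (pins q) ρ x → Unpinned (pins q) ρ y →
                  ⟦ q ⟧ (x ∷ᵃ ρ) ⇔ ⟦ q ⟧ (y ∷ᵃ ρ)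
  indiscernible q agree x-free y-free =
    atoms-cong q (All.tabulate λ a∈ →
      atom-indiscernible _ (restrict a∈ agree) (restrict a∈ x-free) (restrict a∈ y-free))
    where
    restrict : ∀ {a b p} {B : Set b} {P : B → Set p} {f : Atom → List B} →
               a ∈ atoms q → All P (concatMap f (atoms q)) → All P (f a)
    restrict a∈ h = All.lookup (map⁻ (concat⁻ h)) a∈

  substPreimage : (R : Relation U) → 𝓡 R → ℕ → Atom → QF
  substPreimage R r j (rel S s zero zero) =
    atom (rel (R ∘ʳ (S ∘ʳ (R ⁻¹ʳ))) (r ∘ᵣ s ∘ᵣ r ⁻¹ᵣ) j j)
  substPreimage R r j (rel S s zero (suc k)) = atom (rel (S ∘ʳ (R ⁻¹ʳ)) (s ∘ᵣ r ⁻¹ᵣ) j k)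
  substPreimage R r j (rel S s (suc k) zero) = atom (rel (R ∘ʳ S) (r ∘ᵣ s) k j)
  substPreimage R r j (rel S s (suc k) (suc l)) = atom (rel S s k l)
  substPreimage R r j (eq zero zero) = ⊤q
  substPreimage R r j (eq zero (suc k)) = atom (rel R r k j)
  substPreimage R r j (eq (suc k) zero) = atom (rel R r k j)
  substPreimage R r j (eq (suc k) (suc l)) = atom (eq k l)

  substPreimage-sound : ∀ R r j {ρ x} → R x (ρ j) →
                        ∀ a → ⟦ substPreimage R r j a ⟧ ρ ⇔ ⟦ atom a ⟧ (x ∷ᵃ ρ)
  substPreimage-sound R r j {ρ} {x} Rx = sound
    where
    preimage-unique : ∀ {y} → R y (ρ j) → y ≡ x
    preimage-unique Ry = proj₂ (partialBijection R r) _ _ _ Ry Rx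

    sound : ∀ a → ⟦ substPreimage R r j a ⟧ ρ ⇔ ⟦ atom a ⟧ (x ∷ᵃ ρ)
    sound (rel S s zero zero) =
      mk⇔ (λ { (_ , (_ , Ry , Syz) , Rz) → subst₂ S (preimage-unique Ry) (preimage-unique Rz) Syz })
          (λ Sxx → x , (x , Rx , Sxx) , Rx)
    sound (rel S s zero (suc k)) =
      mk⇔ (λ { (_ , Ry , Sy) → subst (λ y → S y (ρ k)) (preimage-unique Ry) Sy }) (λ Sx → x , Rx , Sx)
    sound (rel S s (suc k) zero) =
      mk⇔ (λ { (_ , Sy , Ry) → subst (S (ρ k)) (preimage-unique Ry) Sy }) (λ Sx → x , Sx , Rx)
    sound (rel S s (suc k) (suc l)) = ⇔-id _
    sound (eq zero zero) = mk⇔ (λ _ → refl) (λ _ → tt)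
    sound (eq zero (suc k)) = mk⇔ (sym ∘ preimage-unique) (λ { refl → Rx })
    sound (eq (suc k) zero) = mk⇔ preimage-unique (λ { refl → Rx })
    sound (eq (suc k) (suc l)) = ⇔-id _

  ∃pinned : QF → Pin → QF
  ∃pinned q (via R r j) =
    atom (rel (R ∘ʳ (R ⁻¹ʳ)) (r ∘ᵣ r ⁻¹ᵣ) j j) ∧q bind (substPreimage R r j) q
  ∃pinned q (at j) = q [ var j /0]

  ∃pinned-sound : ∀ q p {ρ} → ⟦ ∃pinned q p ⟧ ρ ⇔ (∃[ x ] Pinned p ρ x × ⟦ q ⟧ (x ∷ᵃ ρ))
  ∃pinned-sound q (via R r j) =
    mk⇔ (λ { ((x , Rx , _) , h) → x , Rx , to (preimage Rx) h })
        (λ (x , Rx , h) → (x , Rx , Rx) , from (preimage Rx) h)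
    where
    preimage : ∀ {ρ x} → R x (ρ j) → ⟦ bind (substPreimage R r j) q ⟧ ρ ⇔ ⟦ q ⟧ (x ∷ᵃ ρ)
    preimage Rx = bind-sound (substPreimage R r j) q (All.universal (substPreimage-sound R r j Rx) _)
  ∃pinned-sound q (at j) {ρ} =
    mk⇔ (λ h → ρ j , refl , to ([/0]-sound q (var j)) h)
        (λ { (_ , refl , h) → from ([/0]-sound q (var j)) h })

  witnessCover : ∀ q → ∃[ L ] Covers (length (pins q)) (loops q) (λ _ → ⊤) L
  witnessCover q = cover (length (pins q)) (loops q) (λ _ → ⊤)

  witnesses : QF → List U
  witnesses q = proj₁ (witnessCover q)

  unpinned-witness : ∀ q {ρ x} → Unpinned (pins q) ρ x → ⟦ q ⟧ (x ∷ᵃ ρ) →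
                     ∃[ d ] d ∈ witnesses q × ⟦ q ⟧ (d ∷ᵃ ρ)
  unpinned-witness q {ρ} {x} x-free qx with proj₂ (witnessCover q) {x} tt
  ... | inj₁ x∈L = x , x∈L , qx
  ... | inj₂ (S , uS , |pins|<|S| , S-good)
    with pigeonhole-avoiding (λ p → Pinned p ρ) (pins q) (All.universal (pinned-atMostOne ρ) _) uS |pins|<|S|
  ...   | d , d∈S , d-free with All.lookup S-good d∈S
  ...     | d∈L , _ , agree = d , d∈L , to (indiscernible q agree x-free d-free) qx

  ∃q : QF → QF
  ∃q q = ⋁ (λ d → q [ con d /0]) (witnesses q) ∨q ⋁ (∃pinned q) (pins q)

  ∃q-sound : ∀ q {ρ} → ⟦ ∃q q ⟧ ρ ⇔ (∃[ x ] ⟦ q ⟧ (x ∷ᵃ ρ))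
  ∃q-sound q {ρ} = mk⇔ sound complete
    where
    sound : ⟦ ∃q q ⟧ ρ → ∃[ x ] ⟦ q ⟧ (x ∷ᵃ ρ)
    sound (inj₁ h) with find (to (⋁-sound _ (witnesses q)) h)
    ... | d , _ , qd = d , to ([/0]-sound q (con d)) qd
    sound (inj₂ h) with find (to (⋁-sound (∃pinned q) (pins q)) h)
    ... | p , _ , r with to (∃pinned-sound q p) r
    ...   | x , _ , qx = x , qx

    complete : ∃[ x ] ⟦ q ⟧ (x ∷ᵃ ρ) → ⟦ ∃q q ⟧ ρ
    complete (x , qx) with any? (λ p → em {Pinned p ρ x}) (pins q)
    ... | yes pinned = inj₂ (from (⋁-sound (∃pinned q) (pins q))
                                  (Any.map (λ {p} px → from (∃pinned-sound q p) (x , px , qx)) pinned))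
    ... | no unpinned with unpinned-witness q (¬Any⇒All¬ (pins q) unpinned) qx
    ...   | d , d∈L , qd =
      inj₁ (from (⋁-sound _ (witnesses q)) (lose d∈L (from ([/0]-sound q (con d)) qd)))

  eliminate : (A : Formula U 𝓡) → ∃[ q ] (∀ ρ → Sat A ρ ⇔ ⟦ q ⟧ ρ)
  eliminate (rel R r s t) = relTerms R r s t , λ _ → ⇔-sym (relTerms-sound R r s t)
  eliminate (eqf s t) = eqTerms s t , λ _ → ⇔-sym (eqTerms-sound s t)
  eliminate ⊤f = ⊤q , λ _ → ⇔-id _
  eliminate ⊥f = ⊥q , λ _ → ⇔-id _
  eliminate (¬f A) with eliminate A
  ... | q , A⇔q = ¬q q , λ ρ → ¬-cong-⇔ (A⇔q ρ)
  eliminate (A ∧f B) with eliminate A | eliminate B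
  ... | q , A⇔q | q′ , B⇔q′ = q ∧q q′ , λ ρ → A⇔q ρ ×-⇔ B⇔q′ ρ
  eliminate (A ∨f B) with eliminate A | eliminate B
  ... | q , A⇔q | q′ , B⇔q′ = q ∨q q′ , λ ρ → A⇔q ρ ⊎-⇔ B⇔q′ ρ
  eliminate (A ⇒f B) with eliminate A | eliminate B
  ... | q , A⇔q | q′ , B⇔q′ = q ⇒q q′ , λ ρ → →-cong-⇔ (A⇔q ρ) (B⇔q′ ρ)
  eliminate (∃f A) with eliminate A
  ... | q , A⇔q = ∃q q , λ ρ → ⇔-sym (∃q-sound q) ⇔-∘ congˡ (A⇔q _)
  eliminate (∀f A) with eliminate A
  ... | q , A⇔q = ¬q (∃q (¬q q)) , λ ρ →
    ¬-cong-⇔ (⇔-sym (∃q-sound (¬q q))) ⇔-∘ (∀⇔¬∃¬ ⇔-∘ Π-cong-⇔ (λ _ → A⇔q _))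

theorem7p4 : ExcludedMiddle 0ℓ →
    (U : Set) (𝓡 : Relation U → Set) →
    (∀ R → 𝓡 R → IsPartialBijection R) →
    (∀ R → 𝓡 R → 𝓡 (R ⁻¹ʳ)) →
    (∀ R S → 𝓡 R → 𝓡 S → 𝓡 (R ∘ʳ S)) →
    (∀ (u : U) → 𝓡 (idSingleton u)) →
    (A : Formula U 𝓡) →
    Σ (Formula U 𝓡) (λ C → QFConstFree C × Equivalent A C)
theorem7p4 em U 𝓡 partialBijection inverse composition singleton A =
  let q , A⇔q = eliminate A in ⌜ q ⌝ , ⌜⌝-qfConstFree q , λ ρ → to (A⇔q ρ) , from (A⇔q ρ)
  where
  open QuantifierFree U 𝓡
  open QuantifierElimination em U 𝓡 partialBijection inverse composition singleton
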